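{- Let $C=(C_n)_{n\ge1}$ be a strong divisibility sequence and let $p$ be an ideal prime for $C$ (with associated integer $s(p)\ge1$). Then for any integer $n\ge0$ with standard base-$p$ representation $n=n_\ell\cdots n_1n_0$ (digits $n_i\in\{0,\dots,p-1\}$), and for any integer $0\le r<\alpha(p)$, \[ T_{p,C}(\alpha(p)\cdot n+r,x)=\begin{bmatrix} r+1 & (\alpha(p)-r-1)x^{s(p)-1}\end{bmatrix} M_p(n_0)M_p(n_1)\cdots M_p(n_\ell)\begin{bmatrix}1\\0\end{bmatrix}. \]
   Context: A strong divisibility sequence is a sequence $C=C_1,C_2,\dots$ of nonzero integers with $\gcd(C_n,C_m)=C_{\gcd(n,m)}$ for all positive $n,m$. The $C$-orial is $0!_C=1$, $n!_C=C_nC_{n-1}\cdots C_1$ for $n\ge1$, and the $C$-nomial coefficient is $\binom{n}{m}_C=\frac{n!_C}{m!_C(n-m)!_C}$ for $0\le m\le n$ (an integer). For a prime $p$, $\nu_p$ is the $p$-adic valuation, and $T_{p,C}(n,x)=\sum_{m=0}^n x^{\nu_p(\binom{n}{m}_C)}$. The rank of apparition $\alpha(m)$ is the least index $j\ge1$ with $m\mid C_j$ (if it exists). When $\alpha(p^k)$ exists for all $k\ge1$, set $a_1(p)=\alpha(p)$ and $a_k(p)=\alpha(p^k)/\alpha(p^{k-1})$ for $k\ge2$. The prime $p$ is ideal for $C$ if $\alpha(p^k)$ exists for all $k\ge1$ and there is an integer $s(p)\ge1$ with $a_k(p)=1$ for $2\le k\le s(p)$ and $a_k(p)=p$ for $k>s(p)$.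 For $d\in\{0,1,\dots,p-1\}$, $M_p(d)=\begin{bmatrix} d+1 & p-d-1\\ dx & (p-d)x\end{bmatrix}$. -}

module Defs where

open import Level using (Level)
open import Data.Bool using (Bool; true; false; if_then_else_)
open import Data.Nat as ℕ using (ℕ; zero; suc; _≤_; _<_; _∸_; _≡ᵇ_)
import Data.Nat.DivMod as ℕD
import Data.Nat.Divisibility as ℕDiv
open import Data.Nat.GCD using (gcd)
open import Data.Integer as ℤ using (ℤ; +_; -[1+_]; ∣_∣)
import Data.Integer.DivMod as ℤD
open import Data.Integer.GCD as ℤG using ()
open import Data.Integer.Divisibility as ℤDiv using ()
open import Data.List using (List; []; _∷_; foldr; upTo)
open import Data.Product using (_×_; _,_)
open import Relation.Nullary using (¬_; yes; no)
open import Relation.Binary.PropositionalEquality using (_≡_; _≢_)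
open import Algebra.Bundles using (CommutativeSemiring)
import Algebra.Definitions.RawSemiring as RS

-- Sequences are functions ℕ → ℤ; only indices ≥ 1 are meaningful
-- (the value at index 0 is never constrained or used).

IsSDS : (ℕ → ℤ) → Set
IsSDS C = (∀ n → 1 ≤ n → C n ≢ + 0)
        × (∀ n m → 1 ≤ n → 1 ≤ m → ℤG.gcd (C n) (C m) ≡ C (gcd n m))

corial : (ℕ → ℤ) → ℕ → ℤ
corial C zero    = + 1
corial C (suc n) = C (suc n) ℤ.* corial C n

-- integer division, total (returns 0 for divisor 0, never used then)
divℤ : ℤ → ℤ → ℤ
divℤ a (+ zero)    = + 0
divℤ a (+ suc d)   = a ℤD./ (+ suc d)
divℤ a (-[1+ d ])  = a ℤD./ -[1+ d ]

cnomial : (ℕ → ℤ) → ℕ → ℕ → ℤ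
cnomial C n m = divℤ (corial C n) (corial C m ℤ.* corial C (n ∸ m))

-- p-adic valuation of a natural number (computed with fuel; the fuel k
-- suffices for p ≥ 2 and k ≥ 1). Value at k = 0 is irrelevant (0).
νℕ-go : ℕ → ℕ → ℕ → ℕ
νℕ-go zero    p       k      = 0
νℕ-go (suc f) p       zero   = 0
νℕ-go (suc f) zero    (suc k) = 0
νℕ-go (suc f) (suc q) (suc k) with suc q ℕDiv.∣? suc k
... | yes _ = suc (νℕ-go f (suc q) (ℕD._/_ (suc k) (suc q)))
... | no  _ = 0

ν : ℕ → ℤ → ℕ
ν p z = νℕ-go (∣ z ∣) p (∣ z ∣)

-- standard base-p digits of n, least significant first:
-- n = n_ℓ ... n_1 n_0 gives [n_0 , n_1 , ... , n_ℓ], no leading zeros,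
-- and 0 gives [0]. (Fuel n+1 suffices for p ≥ 2.)
digits-go : ℕ → ℕ → ℕ → List ℕ
digits-go zero    p       n = []
digits-go (suc f) zero    n = []
digits-go (suc f) (suc q) n =
  ℕD._%_ n (suc q) ∷
    (if ℕD._/_ n (suc q) ≡ᵇ 0 then [] else digits-go f (suc q) (ℕD._/_ n (suc q)))

digits : ℕ → ℕ → List ℕ
digits p n = digits-go (suc n) p n

IsRank : (ℕ → ℤ) → ℕ → ℕ → Set
IsRank C m j = 1 ≤ j × (+ m ℤDiv.∣ C j) × (∀ i → 1 ≤ i → i < j → ¬ (+ m ℤDiv.∣ C i))

divℕ : ℕ → ℕ → ℕ
divℕ a zero    = 0
divℕ a (suc b) = ℕD._/_ a (suc b)

-- given α k = α(p^k), the numbers a_k(p)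
aₖ : (ℕ → ℕ) → ℕ → ℕ
aₖ α zero          = 0   -- unused
aₖ α (suc zero)    = α 1
aₖ α (suc (suc k)) = divℕ (α (suc (suc k))) (α (suc k))

-- p is ideal for C, where α k is the rank of apparition of p^k
-- (so all α(p^k) exist) and s is the associated s(p).
IsIdeal : (ℕ → ℤ) → ℕ → (ℕ → ℕ) → ℕ → Set
IsIdeal C p α s =
    (∀ k → 1 ≤ k → IsRank C (p ℕ.^ k) (α k))
  × 1 ≤ s
  × (∀ k → 2 ≤ k → k ≤ s → aₖ α k ≡ 1)
  × (∀ k → s < k → aₖ α k ≡ p)

-- Polynomials in x are handled by evaluation at an arbitrary element x
-- of an arbitrary commutative semiring (equivalent to an identity in ℕ[x]).

module _ {c ℓ : Level} (R : CommutativeSemiring c ℓ) where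
  open CommutativeSemiring R renaming (Carrier to A)
  open RS rawSemiring using (_^_) renaming (_×_ to _·_)

  nat : ℕ → A
  nat n = n · 1#

  T : ℕ → (ℕ → ℤ) → ℕ → A → A
  T p C n x = foldr (λ m acc → (x ^ ν p (cnomial C n m)) + acc) 0# (upTo (suc n))

  -- M_p(d) applied to a column vector (u , v)
  Mp· : ℕ → A → ℕ → A × A → A × A
  Mp· p x d (u , v) =
    ( nat (suc d) * u + nat (p ∸ d ∸ 1) * v
    , (nat d * x) * u + (nat (p ∸ d) * x) * v )

  -- M_p(n_0) M_p(n_1) ⋯ M_p(n_ℓ) [1 ; 0]
  Mprod : ℕ → A → List ℕ → A × A
  Mprod p x ds = foldr (Mp· p x) (1# , 0#) ds

  rowcol : A × A → A × A → A
  rowcol (a , b) (u , v) = a * u + b * v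

  RHS : ℕ → (ℕ → ℕ) → ℕ → ℕ → ℕ → A → A
  RHS p α s n r x =
    rowcol (nat (suc r) , nat (α 1 ∸ r ∸ 1) * x ^ (s ∸ 1)) (Mprod p x (digits p n))

{-# OPTIONS --safe #-}
-- Since p is ideal, ν_p(C_j) = 0 unless α(p) ∣ j, and ν_p(C_{α(p) t}) = s(p) + ν_p(t). Summing,
-- ν_p(N!_C) = s(p) Q + ν_p(Q!) with Q = ⌊N / α(p)⌋. So for N = α(p) n + r and m = α(p) M + j the
-- valuation of the C-nomial coefficient is the Legendre exponent ν_p(n!) − ν_p(M!) − ν_p((n−M)!)
-- when j ≤ r, and s(p) + ν_p(n!) − ν_p(M!) − ν_p((n−M−1)!) when j > r (a borrow from the last base
-- α(p) digit). Grouping the m by their last digit expresses T_{p,C}(N, x) through the two sums Z₀(n)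
-- and Z₁(n) of x to these Legendre exponents. The same computation for C_j = j (where α = p, s = 1)
-- shows that (Z₀, x Z₁) at p n′ + d is M_p(d) applied to its value at n′; unwinding the base-p
-- digits of n gives the matrix product.
module Submission where

open import Defs
open import Level using (Level)
open import Data.Nat using (ℕ; _<_; _*_; _+_)
open import Data.Nat.Primality using (Prime)
open import Data.Integer using (ℤ)
open import Algebra.Bundles using (CommutativeSemiring)

open import Data.Bool using (if_then_else_)
open import Data.List using (List; foldr; applyUpTo; []; _∷_)
open import Data.Nat.Base
  using ( zero; suc; _∸_; _≤_; _≡ᵇ_; _!; s≤s; z≤n; s<s; z<s
        ; NonZero; ≢-nonZero; ≢-nonZero⁻¹; >-nonZero; >-nonZero⁻¹; nonTrivial⇒n>1 )
open import Data.Nat.Combinatorics using (k![n∸k]!∣n!)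
open import Data.Nat.Divisibility
  using ( _∣_; divides; quotient; _∣?_; 1∣_; ∣-refl; ∣-reflexive; ∣-trans; ∣-antisym; ∣⇒≤; >⇒∤
        ; ∣m∣n⇒∣m+n; ∣m+n∣m⇒∣n; n∣m*n; m∣m*n; m*n∣⇒m∣; m*n∣o⇒n∣o/m; m∣n/o⇒o*m∣n
        ; *-monoʳ-∣; *-monoˡ-∣; *-cancelˡ-∣; *-cancelʳ-∣; m∣n⇒n≡quotient*m )
open import Data.Nat.DivMod using (_/_; _%_; m/n*n≡m; m/n<m; m%n<n; 0/n≡0; m≡m%n+[m/n]*n)
open import Data.Nat.GCD using (gcd; gcd[m,n]∣m; gcd[m,n]∣n; gcd-greatest; gcd[m,n]≢0; c*gcd[m,n]≡gcd[cm,cn])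
open import Data.Nat.Primality using (euclidsLemma; prime⇒nonTrivial)
open import Data.Nat.Properties using (m*n≢0; m*n≢0⇒m≢0; m^n≢0; n<1+n; _!≢0; _!*_!≢0)
import Data.Nat.Properties as ℕₚ
open import Data.Nat.Tactic.RingSolver using (solve-∀)
import Data.Integer.Base as ℤ
import Data.Integer.DivMod as ℤDivMod
import Data.Integer.Properties as ℤₚ
open import Data.Product using (_,_; proj₁; proj₂)
open import Data.Product.Relation.Binary.Pointwise.NonDependent using (×-setoid)
open import Data.Sum using ([_,_]′; inj₁; inj₂)
open import Function using (_∘_; id)
open import Function.Bundles using (_⇔_; mk⇔; Equivalence)
open import Relation.Binary.Bundles using (Setoid)
open import Relation.Binary.PropositionalEquality as ≡ using (_≡_)
import Relation.Binary.Reasoning.Setoid as SetoidReasoning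
open import Relation.Nullary using (¬_; yes; no; contradiction)
import Algebra.Properties.CommutativeSemigroup as CommSemigroupProperties
import Algebra.Properties.Semiring.Exp as SemiringExp
import Algebra.Properties.Semiring.Mult as SemiringMult
import Algebra.Solver.Ring.NaturalCoefficients.Default as SemiringSolver

module +-Comm = CommSemigroupProperties ℕₚ.+-commutativeSemigroup
module *-Comm = CommSemigroupProperties ℕₚ.*-commutativeSemigroup

m∸n∸1≡m∸[1+n] : ∀ m n → m ∸ n ∸ 1 ≡ m ∸ suc n
m∸n∸1≡m∸[1+n] m n = ≡.trans (ℕₚ.∸-+-assoc m n 1) (≡.cong (m ∸_) (ℕₚ.+-comm n 1))

module FiniteSums {c ℓ : Level} (R : CommutativeSemiring c ℓ) where
  open CommutativeSemiring R renaming (Carrier to A; _+_ to _⊕_; _*_ to _⊗_)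
  open SemiringMult semiring using (_×_; ×-assoc-*; ×-congʳ)
  open CommSemigroupProperties +-commutativeSemigroup using (interchange)
  open SemiringSolver R using (_:+_; _:*_; _:=_) renaming (solve to solveᴿ)
  open SetoidReasoning setoid

  ∑< : ℕ → (ℕ → A) → A
  ∑< zero    f = 0#
  ∑< (suc n) f = f 0 ⊕ ∑< n (f ∘ suc)

  foldr-applyUpTo : ∀ (g : ℕ → A) h n →
    foldr (λ m acc → g m ⊕ acc) 0# (applyUpTo h n) ≡ ∑< n (g ∘ h)
  foldr-applyUpTo g h zero    = ≡.refl
  foldr-applyUpTo g h (suc n) = ≡.cong (g (h 0) ⊕_) (foldr-applyUpTo g (h ∘ suc) n)

  ∑<-cong : ∀ n {f g : ℕ → A} → (∀ {i} → i < n → f i ≈ g i) → ∑< n f ≈ ∑< n g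
  ∑<-cong zero    f≈g = refl
  ∑<-cong (suc n) f≈g = +-cong (f≈g (s≤s z≤n)) (∑<-cong n (f≈g ∘ s≤s))

  ∑<-+ : ∀ m n (f : ℕ → A) → ∑< (m + n) f ≈ ∑< m f ⊕ ∑< n (λ i → f (m + i))
  ∑<-+ zero    n f = sym (+-identityˡ _)
  ∑<-+ (suc m) n f = trans (+-congˡ (∑<-+ m n (f ∘ suc))) (sym (+-assoc _ _ _))

  ∑<-suc : ∀ n (f : ℕ → A) → ∑< (suc n) f ≈ ∑< n f ⊕ f n
  ∑<-suc zero    f = +-comm _ _
  ∑<-suc (suc n) f = trans (+-congˡ (∑<-suc n (f ∘ suc))) (sym (+-assoc _ _ _))

  ∑<-const : ∀ n {f : ℕ → A} {k} → (∀ {i} → i < n → f i ≈ k) → ∑< n f ≈ nat R n ⊗ k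
  ∑<-const n {f} {k} f≈k = begin
    ∑< n f             ≈⟨ ∑<-cong n f≈k ⟩
    ∑< n (λ _ → k)     ≡⟨ ∑<-replicate n ⟩
    n × k              ≈⟨ ×-congʳ n (*-identityˡ k) ⟨
    n × (1# ⊗ k)       ≈⟨ ×-assoc-* n 1# k ⟨
    nat R n ⊗ k        ∎
    where
    ∑<-replicate : ∀ n → ∑< n (λ _ → k) ≡ n × k
    ∑<-replicate zero    = ≡.refl
    ∑<-replicate (suc n) = ≡.cong (k ⊕_) (∑<-replicate n)

  ∑<-+-distrib : ∀ n (f g : ℕ → A) → ∑< n (λ i → f i ⊕ g i) ≈ ∑< n f ⊕ ∑< n g
  ∑<-+-distrib zero    f g = sym (+-identityˡ 0#)
  ∑<-+-distrib (suc n) f g = trans (+-congˡ (∑<-+-distrib n (f ∘ suc) (g ∘ suc))) (interchange _ _ _ _)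

  *-distribˡ-∑< : ∀ n k (f : ℕ → A) → ∑< n (λ i → k ⊗ f i) ≈ k ⊗ ∑< n f
  *-distribˡ-∑< zero    k f = sym (zeroʳ k)
  *-distribˡ-∑< (suc n) k f = trans (+-congˡ (*-distribˡ-∑< n k (f ∘ suc))) (sym (distribˡ k _ _))

  ∑<-* : ∀ a Q (f : ℕ → A) → ∑< (a * Q) f ≈ ∑< Q (λ M → ∑< a (λ j → f (a * M + j)))
  ∑<-* a zero    f = reflexive (≡.cong (λ n → ∑< n f) (ℕₚ.*-zeroʳ a))
  ∑<-* a (suc Q) f = begin
    ∑< (a * suc Q) f
      ≡⟨ ≡.cong (λ n → ∑< n f) (ℕₚ.*-suc a Q) ⟩
    ∑< (a + a * Q) f
      ≈⟨ ∑<-+ a (a * Q) f ⟩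
    ∑< a f ⊕ ∑< (a * Q) (λ i → f (a + i))
      ≈⟨ +-congˡ (∑<-* a Q (λ i → f (a + i))) ⟩
    ∑< a f ⊕ ∑< Q (λ M → ∑< a (λ j → f (a + (a * M + j))))
      ≈⟨ +-cong (∑<-cong a λ {j} _ → reflexive (≡.cong (λ m → f (m + j)) (ℕₚ.*-zeroʳ a)))
                (∑<-cong Q λ {M} _ → ∑<-cong a λ {j} _ → reflexive (≡.cong f (shift M j))) ⟨
    ∑< (suc Q) (λ M → ∑< a (λ j → f (a * M + j))) ∎
    where
    shift : ∀ M j → a * suc M + j ≡ a + (a * M + j)
    shift M j = ≡.trans (≡.cong (_+ j) (ℕₚ.*-suc a M)) (ℕₚ.+-assoc a (a * M) j)

  ∑<-lastDigit : ∀ a Q {r} → r < a → (f g h : ℕ → A) →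
    (∀ {M j} → M ≤ Q → j ≤ r → f (a * M + j) ≈ g M) →
    (∀ {M j} → M < Q → r < j → j < a → f (a * M + j) ≈ h M) →
    ∑< (a * Q + suc r) f ≈ nat R (suc r) ⊗ ∑< (suc Q) g ⊕ nat R (a ∸ r ∸ 1) ⊗ ∑< Q h
  ∑<-lastDigit a Q {r} r<a f g h low high = begin
    ∑< (a * Q + suc r) f
      ≈⟨ ∑<-+ (a * Q) (suc r) f ⟩
    ∑< (a * Q) f ⊕ ∑< (suc r) (λ j → f (a * Q + j))
      ≈⟨ +-cong (∑<-* a Q f) (∑<-const (suc r) (low ℕₚ.≤-refl ∘ ℕₚ.≤-pred)) ⟩
    ∑< Q (λ M → ∑< a (λ j → f (a * M + j))) ⊕ u ⊗ g Q
      ≈⟨ +-congʳ (∑<-cong Q fullBlock) ⟩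
    ∑< Q (λ M → u ⊗ g M ⊕ v ⊗ h M) ⊕ u ⊗ g Q
      ≈⟨ +-congʳ (trans (∑<-+-distrib Q _ _) (+-cong (*-distribˡ-∑< Q u g) (*-distribˡ-∑< Q v h))) ⟩
    (u ⊗ ∑< Q g ⊕ v ⊗ ∑< Q h) ⊕ u ⊗ g Q
      ≈⟨ solveᴿ 5 (λ u v G H g → (u :* G :+ v :* H) :+ u :* g := u :* (G :+ g) :+ v :* H) refl _ _ _ _ _ ⟩
    u ⊗ (∑< Q g ⊕ g Q) ⊕ v ⊗ ∑< Q h
      ≈⟨ +-congʳ (*-congˡ (∑<-suc Q g)) ⟨
    u ⊗ ∑< (suc Q) g ⊕ v ⊗ ∑< Q h ∎
    where
    u v : A
    u = nat R (suc r)
    v = nat R (a ∸ r ∸ 1)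
    digitSplit : suc r + (a ∸ r ∸ 1) ≡ a
    digitSplit = ≡.trans (≡.cong (suc r +_) (m∸n∸1≡m∸[1+n] a r)) (ℕₚ.m+[n∸m]≡n r<a)
    fullBlock : ∀ {M} → M < Q → ∑< a (λ j → f (a * M + j)) ≈ u ⊗ g M ⊕ v ⊗ h M
    fullBlock {M} M<Q = begin
      ∑< a (λ j → f (a * M + j))
        ≡⟨ ≡.cong (λ n → ∑< n (λ j → f (a * M + j))) digitSplit ⟨
      ∑< (suc r + (a ∸ r ∸ 1)) (λ j → f (a * M + j))
        ≈⟨ ∑<-+ (suc r) (a ∸ r ∸ 1) (λ j → f (a * M + j)) ⟩
      ∑< (suc r) (λ j → f (a * M + j)) ⊕ ∑< (a ∸ r ∸ 1) (λ i → f (a * M + (suc r + i)))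
        ≈⟨ +-cong (∑<-const (suc r) (low (ℕₚ.<⇒≤ M<Q) ∘ ℕₚ.≤-pred))
                  (∑<-const (a ∸ r ∸ 1) λ {i} i<v → high M<Q (s<s (ℕₚ.m≤m+n r i))
                     (≡.subst (suc r + i <_) digitSplit (ℕₚ.+-monoʳ-< (suc r) i<v))) ⟩
      u ⊗ g M ⊕ v ⊗ h M ∎

module Valuation where
  open import Data.Nat.Base using (_^_)

  νₙ : ℕ → ℕ → ℕ
  νₙ p n = νℕ-go n p n

  νℕ-go-spec : ∀ {p} → 1 < p → ∀ {f n} .{{_ : NonZero n}} → n ≤ f →
               ∀ v → p ^ v ∣ n ⇔ v ≤ νℕ-go f p n
  νℕ-go-spec {suc p-1} 1<p {suc f} {suc k} (s≤s k≤f) v with suc p-1 ∣? suc k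
  ... | yes p∣n = mk⇔ (to v) (from v)
    where
    p n : ℕ
    p = suc p-1
    n = suc k
    instance
      n/p≢0 : NonZero (n / p)
      n/p≢0 = ≢-nonZero λ n/p≡0 → ℕₚ.0≢1+n (≡.trans (≡.cong (_* p) (≡.sym n/p≡0)) (m/n*n≡m p∣n))
    spec : ∀ v → p ^ v ∣ n / p ⇔ v ≤ νℕ-go f p (n / p)
    spec = νℕ-go-spec 1<p (ℕₚ.≤-pred (ℕₚ.≤-trans (m/n<m n p 1<p) (s≤s k≤f)))
    to : ∀ v → p ^ v ∣ n → v ≤ suc (νℕ-go f p (n / p))
    to zero    _ = z≤n
    to (suc v) h = s≤s (Equivalence.to (spec v) (m*n∣o⇒n∣o/m p (p ^ v) h))
    from : ∀ v → v ≤ suc (νℕ-go f p (n / p)) → p ^ v ∣ n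
    from zero    _       = 1∣ n
    from (suc v) (s≤s h) = m∣n/o⇒o*m∣n p∣n (Equivalence.from (spec v) h)
  ... | no p∤n = mk⇔ (to v) (from v)
    where
    to : ∀ v → suc p-1 ^ v ∣ suc k → v ≤ 0
    to zero    _ = z≤n
    to (suc v) h = contradiction (m*n∣⇒m∣ (suc p-1) _ h) p∤n
    from : ∀ v → v ≤ 0 → suc p-1 ^ v ∣ suc k
    from zero _ = 1∣ _

  module Properties {p : ℕ} (1<p : 1 < p) where
    open ≡.≡-Reasoning

    instance
      p≢0 : NonZero p
      p≢0 = >-nonZero (ℕₚ.<-trans z<s 1<p)

    p^v∣n⇔v≤νₙ : ∀ {n} .{{_ : NonZero n}} v → p ^ v ∣ n ⇔ v ≤ νₙ p n
    p^v∣n⇔v≤νₙ = νℕ-go-spec 1<p ℕₚ.≤-refl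

    p^νₙ∣n : ∀ n .{{_ : NonZero n}} → p ^ νₙ p n ∣ n
    p^νₙ∣n n = Equivalence.from (p^v∣n⇔v≤νₙ _) ℕₚ.≤-refl

    p^1+νₙ∤n : ∀ n .{{_ : NonZero n}} → ¬ p ^ suc (νₙ p n) ∣ n
    p^1+νₙ∤n n h = ℕₚ.<-irrefl ≡.refl (Equivalence.to (p^v∣n⇔v≤νₙ _) h)

    νₙ-unique : ∀ {n v} .{{_ : NonZero n}} → p ^ v ∣ n → ¬ p ^ suc v ∣ n → νₙ p n ≡ v
    νₙ-unique {n} {v} p^v∣n p^1+v∤n = ℕₚ.≤-antisym νₙ≤v (Equivalence.to (p^v∣n⇔v≤νₙ v) p^v∣n)
      where
      νₙ≤v : νₙ p n ≤ v
      νₙ≤v = ℕₚ.≮⇒≥ (p^1+v∤n ∘ Equivalence.from (p^v∣n⇔v≤νₙ (suc v)))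

    νₙ≡0 : ∀ {n} .{{_ : NonZero n}} → ¬ p ∣ n → νₙ p n ≡ 0
    νₙ≡0 p∤n = νₙ-unique (1∣ _) (p∤n ∘ m*n∣⇒m∣ p 1)

    νₙ-mono-∣ : ∀ {m n} .{{_ : NonZero m}} .{{_ : NonZero n}} → m ∣ n → νₙ p m ≤ νₙ p n
    νₙ-mono-∣ {m} m∣n = Equivalence.to (p^v∣n⇔v≤νₙ _) (∣-trans (p^νₙ∣n m) m∣n)

    νₙ-p* : ∀ n .{{_ : NonZero n}} → νₙ p (p * n) ≡ suc (νₙ p n)
    νₙ-p* n = νₙ-unique {{m*n≢0 p n}} (*-monoʳ-∣ p (p^νₙ∣n n)) (p^1+νₙ∤n n ∘ *-cancelˡ-∣ p)

    νₙ-* : Prime p → ∀ m n .{{_ : NonZero m}} .{{_ : NonZero n}} → νₙ p (m * n) ≡ νₙ p m + νₙ p n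
    νₙ-* p-prime m n = νₙ-unique {{m*n≢0 m n}} p^[v+w]∣mn p^1+[v+w]∤mn
      where
      v w m′ n′ : ℕ
      v = νₙ p m
      w = νₙ p n
      m′ = quotient (p^νₙ∣n m)
      n′ = quotient (p^νₙ∣n n)
      p∤quotient : ∀ k .{{_ : NonZero k}} → ¬ p ∣ quotient (p^νₙ∣n k)
      p∤quotient k p∣k′ = p^1+νₙ∤n k
        (≡.subst (p ^ suc (νₙ p k) ∣_) (≡.sym (m∣n⇒n≡quotient*m (p^νₙ∣n k))) (*-monoˡ-∣ (p ^ νₙ p k) p∣k′))
      mn≡ : m * n ≡ (m′ * n′) * p ^ (v + w)
      mn≡ = begin
        m * n
          ≡⟨ ≡.cong₂ _*_ (m∣n⇒n≡quotient*m (p^νₙ∣n m)) (m∣n⇒n≡quotient*m (p^νₙ∣n n)) ⟩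
        (m′ * p ^ v) * (n′ * p ^ w)
          ≡⟨ ℕₚ.[m*n]*[o*p]≡[m*o]*[n*p] m′ (p ^ v) n′ (p ^ w) ⟩
        (m′ * n′) * (p ^ v * p ^ w)
          ≡⟨ ≡.cong ((m′ * n′) *_) (ℕₚ.^-distribˡ-+-* p v w) ⟨
        (m′ * n′) * p ^ (v + w) ∎
      p^[v+w]∣mn : p ^ (v + w) ∣ m * n
      p^[v+w]∣mn = divides (m′ * n′) mn≡
      p^1+[v+w]∤mn : ¬ p ^ suc (v + w) ∣ m * n
      p^1+[v+w]∤mn h = [ p∤quotient m , p∤quotient n ]′ (euclidsLemma m′ n′ p-prime
        (*-cancelʳ-∣ (p ^ (v + w)) {{m^n≢0 p (v + w)}} (≡.subst (p ^ suc (v + w) ∣_) mn≡ h)))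

open Valuation using (νₙ)

partialSum : (ℕ → ℕ) → ℕ → ℕ
partialSum g zero    = 0
partialSum g (suc n) = g (suc n) + partialSum g n

partialSum-digits : ∀ {a s} {g h : ℕ → ℕ} .{{_ : NonZero a}} →
  (∀ {j} → ¬ a ∣ suc j → g (suc j) ≡ 0) →
  (∀ t → g (a * suc t) ≡ s + h (suc t)) →
  ∀ N {r} → r < a → partialSum g (a * N + r) ≡ s * N + partialSum h N
partialSum-digits {suc a-1} {s} {g} {h} g-off g-on = anyDigit
  where
  open ≡.≡-Reasoning
  a : ℕ
  a = suc a-1
  inBlock : ∀ N {r} → r < a → partialSum g (a * N + r) ≡ partialSum g (a * N)
  inBlock N {zero}  _     = ≡.cong (partialSum g) (ℕₚ.+-identityʳ (a * N))
  inBlock N {suc r} 1+r<a = begin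
    partialSum g (a * N + suc r)                 ≡⟨ ≡.cong (partialSum g) (ℕₚ.+-suc (a * N) r) ⟩
    g (suc (a * N + r)) + partialSum g (a * N + r) ≡⟨ ≡.cong₂ _+_ (g-off a∤) (inBlock N (ℕₚ.<-trans (n<1+n r) 1+r<a)) ⟩
    partialSum g (a * N)                         ∎
    where
    a∤ : ¬ a ∣ suc (a * N + r)
    a∤ a∣ = >⇒∤ 1+r<a (∣m+n∣m⇒∣n (≡.subst (a ∣_) (≡.sym (ℕₚ.+-suc (a * N) r)) a∣) (m∣m*n N))
  anyDigit : ∀ N {r} → r < a → partialSum g (a * N + r) ≡ s * N + partialSum h N
  lastBlock : ∀ N → partialSum g (a * N) ≡ s * N + partialSum h N
  anyDigit N r<a = ≡.trans (inBlock N r<a) (lastBlock N)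
  lastBlock zero    = ≡.trans (≡.cong (partialSum g) (ℕₚ.*-zeroʳ a)) (≡.cong (_+ 0) (≡.sym (ℕₚ.*-zeroʳ s)))
  lastBlock (suc N) = begin
    partialSum g (a * suc N)                            ≡⟨ ≡.cong (partialSum g) a[1+N]≡ ⟩
    g (suc (a * N + a-1)) + partialSum g (a * N + a-1)  ≡⟨ ≡.cong₂ _+_ g[a[1+N]]≡ (anyDigit N ℕₚ.≤-refl) ⟩
    (s + h (suc N)) + (s * N + partialSum h N)          ≡⟨ rearrange s N (h (suc N)) (partialSum h N) ⟩
    s * suc N + partialSum h (suc N)                    ∎
    where
    a[1+N]≡ : a * suc N ≡ suc (a * N + a-1)
    a[1+N]≡ = ≡.trans (ℕₚ.*-suc a N) (≡.cong suc (ℕₚ.+-comm a-1 (a * N)))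
    g[a[1+N]]≡ : g (suc (a * N + a-1)) ≡ s + h (suc N)
    g[a[1+N]]≡ = ≡.trans (≡.cong g (≡.sym a[1+N]≡)) (g-on N)
    rearrange : ∀ s N x y → (s + x) + (s * N + y) ≡ s * suc N + (x + y)
    rearrange = solve-∀

module Legendre {p : ℕ} (p-prime : Prime p) where
  1<p : 1 < p
  1<p = nonTrivial⇒n>1 p {{prime⇒nonTrivial p-prime}}

  open Valuation.Properties 1<p

  L : ℕ → ℕ
  L = partialSum (νₙ p)

  νₙ-! : ∀ n → νₙ p (n !) ≡ L n
  νₙ-! zero    = νₙ≡0 (>⇒∤ 1<p)
  νₙ-! (suc n) = ≡.trans (νₙ-* p-prime (suc n) (n !) {{_}} {{n !≢0}}) (≡.cong (νₙ p (suc n) +_) (νₙ-! n))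

  L-superadditive : ∀ m n → L m + L n ≤ L (m + n)
  L-superadditive m n = ≡.subst₂ _≤_
    (≡.trans (νₙ-* p-prime (m !) (n !) {{m !≢0}} {{n !≢0}}) (≡.cong₂ _+_ (νₙ-! m) (νₙ-! n)))
    (νₙ-! (m + n))
    (νₙ-mono-∣ {{m !* n !≢0}} {{(m + n) !≢0}} m!n!∣[m+n]!)
    where
    m!n!∣[m+n]! : m ! * n ! ∣ (m + n) !
    m!n!∣[m+n]! = ≡.subst (λ k → m ! * k ! ∣ (m + n) !) (ℕₚ.m+n∸m≡n m n) (k![n∸k]!∣n! (ℕₚ.m≤m+n m n))

  L-digits : ∀ N {r} → r < p → L (p * N + r) ≡ 1 * N + L N
  L-digits = partialSum-digits νₙ≡0 (λ t → νₙ-p* (suc t))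

-- For G n = ν_p(n!_C) and c = 0 this is the valuation of the C-nomial
-- coefficient; for G n = ν_p(n!) it counts the carries of Kummer's theorem.
Δ : (ℕ → ℕ) → ℕ → ℕ → ℕ → ℕ
Δ F c n m = F n ∸ (F m + F (n ∸ m ∸ c))

m≡n+[o+r]⇒m∸n∸o≡r : ∀ {m} n o {r} → m ≡ n + (o + r) → m ∸ n ∸ o ≡ r
m≡n+[o+r]⇒m∸n∸o≡r n o {r} ≡.refl = ≡.trans (≡.cong (_∸ o) (ℕₚ.m+n∸m≡n n (o + r))) (ℕₚ.m+n∸m≡n o r)

module Carries {a s : ℕ} {L F : ℕ → ℕ}
  (F-digits : ∀ N {r} → r < a → F (a * N + r) ≡ s * N + L N)
  (L-superadditive : ∀ m n → L m + L n ≤ L (m + n)) where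
  open ≡.≡-Reasoning

  defect : ∀ {N M K e d j k} → N ≡ M + K + e → d < a → j < a → k < a →
    F (a * N + d) ∸ (F (a * M + j) + F (a * K + k)) ≡ s * e + (L N ∸ (L M + L K))
  defect {N} {M} {K} {e} {d} {j} {k} N≡ d<a j<a k<a = begin
    F (a * N + d) ∸ (F (a * M + j) + F (a * K + k))
      ≡⟨ ≡.cong₂ _∸_ (F-digits N d<a) (≡.cong₂ _+_ (F-digits M j<a) (F-digits K k<a)) ⟩
    (s * N + L N) ∸ ((s * M + L M) + (s * K + L K))
      ≡⟨ ≡.cong₂ _∸_ (≡.trans (≡.cong (λ t → s * t + L N) N≡) (split s M K e (L N)))
                     (+-Comm.interchange (s * M) (L M) (s * K) (L K)) ⟩
    ((s * M + s * K) + (s * e + L N)) ∸ ((s * M + s * K) + (L M + L K))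
      ≡⟨ ℕₚ.[m+n]∸[m+o]≡n∸o (s * M + s * K) (s * e + L N) (L M + L K) ⟩
    (s * e + L N) ∸ (L M + L K)
      ≡⟨ ℕₚ.+-∸-assoc (s * e) LM+LK≤LN ⟩
    s * e + (L N ∸ (L M + L K)) ∎
    where
    split : ∀ s M K e x → s * (M + K + e) + x ≡ (s * M + s * K) + (s * e + x)
    split = solve-∀
    LM+LK≤LN : L M + L K ≤ L N
    LM+LK≤LN = ℕₚ.≤-trans (L-superadditive M K) (≡.subst (λ t → L (M + K) ≤ L t) (≡.sym N≡)
                 (ℕₚ.≤-trans (ℕₚ.m≤m+n (L (M + K)) (L e)) (L-superadditive (M + K) e)))

  Δ-low : ∀ c {N M d j} → M ≤ N → c + j ≤ d → d < a → Δ F c (a * N + d) (a * M + j) ≡ Δ L 0 N M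
  Δ-low c {N} {M} {d} {j} M≤N c+j≤d d<a = begin
    Δ F c (a * N + d) (a * M + j)
      ≡⟨ ≡.cong (λ t → F (a * N + d) ∸ (F (a * M + j) + F t)) (m≡n+[o+r]⇒m∸n∸o≡r (a * M + j) c n≡m+[c+rest]) ⟩
    F (a * N + d) ∸ (F (a * M + j) + F (a * K + k))
      ≡⟨ defect (≡.sym (≡.trans (ℕₚ.+-identityʳ (M + K)) (ℕₚ.m+[n∸m]≡n M≤N))) d<a j<a k<a ⟩
    s * 0 + Δ L 0 N M
      ≡⟨ ≡.cong (_+ Δ L 0 N M) (ℕₚ.*-zeroʳ s) ⟩
    Δ L 0 N M ∎
    where
    K k : ℕ
    K = N ∸ M
    k = d ∸ (c + j)
    j<a : j < a
    j<a = ℕₚ.≤-<-trans (ℕₚ.≤-trans (ℕₚ.m≤n+m j c) c+j≤d) d<a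
    k<a : k < a
    k<a = ℕₚ.≤-<-trans (ℕₚ.m∸n≤m d (c + j)) d<a
    regroup : ∀ a M K c j k → a * (M + K) + ((c + j) + k) ≡ (a * M + j) + (c + (a * K + k))
    regroup = solve-∀
    n≡m+[c+rest] : a * N + d ≡ (a * M + j) + (c + (a * K + k))
    n≡m+[c+rest] = begin
      a * N + d
        ≡⟨ ≡.cong₂ (λ N d → a * N + d) (ℕₚ.m+[n∸m]≡n M≤N) (ℕₚ.m+[n∸m]≡n c+j≤d) ⟨
      a * (M + K) + ((c + j) + k)
        ≡⟨ regroup a M K c j k ⟩
      (a * M + j) + (c + (a * K + k)) ∎

  Δ-high : ∀ c {N M d j} → c ≤ 1 → M < N → d < c + j → j < a →
           Δ F c (a * N + d) (a * M + j) ≡ s + Δ L 1 N M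
  Δ-high c {N} {M} {d} {j} c≤1 M<N d<c+j j<a = begin
    Δ F c (a * N + d) (a * M + j)
      ≡⟨ ≡.cong (λ t → F (a * N + d) ∸ (F (a * M + j) + F t)) (m≡n+[o+r]⇒m∸n∸o≡r (a * M + j) c n≡m+[c+rest]) ⟩
    F (a * N + d) ∸ (F (a * M + j) + F (a * K + k))
      ≡⟨ defect N≡M+K+1 d<a j<a k<a ⟩
    s * 1 + Δ L 1 N M
      ≡⟨ ≡.cong (_+ Δ L 1 N M) (ℕₚ.*-identityʳ s) ⟩
    s + Δ L 1 N M ∎
    where
    K k : ℕ
    K = N ∸ M ∸ 1
    k = (a + d) ∸ (c + j)
    c+j≤a : c + j ≤ a
    c+j≤a = ℕₚ.≤-trans (ℕₚ.+-monoˡ-≤ j c≤1) j<a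
    d<a : d < a
    d<a = ℕₚ.<-≤-trans d<c+j c+j≤a
    k<a : k < a
    k<a = ℕₚ.m<n+o⇒m∸n<o (a + d) (c + j) {{>-nonZero (ℕₚ.≤-<-trans z≤n j<a)}}
            (≡.subst (a + d <_) (ℕₚ.+-comm a (c + j)) (ℕₚ.+-monoʳ-< a d<c+j))
    N≡M+K+1 : N ≡ M + K + 1
    N≡M+K+1 = begin
      N               ≡⟨ ℕₚ.m+[n∸m]≡n M<N ⟨
      suc M + (N ∸ suc M) ≡⟨ ≡.cong (suc M +_) (m∸n∸1≡m∸[1+n] N M) ⟨
      suc (M + K)     ≡⟨ ℕₚ.+-comm 1 (M + K) ⟩
      M + K + 1       ∎
    regroup : ∀ a M K x → a * (M + K + 1) + x ≡ a * M + a * K + (a + x)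
    regroup = solve-∀
    regroup′ : ∀ a M K c j k → a * M + a * K + ((c + j) + k) ≡ (a * M + j) + (c + (a * K + k))
    regroup′ = solve-∀
    n≡m+[c+rest] : a * N + d ≡ (a * M + j) + (c + (a * K + k))
    n≡m+[c+rest] = begin
      a * N + d
        ≡⟨ ≡.cong (λ N → a * N + d) N≡M+K+1 ⟩
      a * (M + K + 1) + d
        ≡⟨ regroup a M K d ⟩
      a * M + a * K + (a + d)
        ≡⟨ ≡.cong (a * M + a * K +_) (ℕₚ.m+[n∸m]≡n (ℕₚ.≤-trans c+j≤a (ℕₚ.m≤m+n a d))) ⟨
      a * M + a * K + ((c + j) + k)
        ≡⟨ regroup′ a M K c j k ⟩
      (a * M + j) + (c + (a * K + k)) ∎

module CarrySums {c ℓ : Level} (R : CommutativeSemiring c ℓ) (x : CommutativeSemiring.Carrier R) where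
  open CommutativeSemiring R renaming (Carrier to A; _+_ to _⊕_; _*_ to _⊗_)
  open SemiringExp semiring using (_^_; ^-homo-*)
  open FiniteSums R
  open SetoidReasoning setoid

  -- Z₀ G is T_{p,C} for G n = ν_p(n!_C); for G n = ν_p(n!) the pair (Z₀ G, x Z₁ G) is the vector
  -- on which the matrices M_p(d) act.
  Z₀ Z₁ : (ℕ → ℕ) → ℕ → A
  Z₀ G n = ∑< (suc n) (λ m → x ^ Δ G 0 n m)
  Z₁ G n = ∑< n (λ m → x ^ Δ G 1 n m)

  module Lift {a s : ℕ} {L F : ℕ → ℕ}
    (F-digits : ∀ N {r} → r < a → F (a * N + r) ≡ s * N + L N)
    (L-superadditive : ∀ m n → L m + L n ≤ L (m + n)) where
    open Carries {a} {s} {L} {F} F-digits L-superadditive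

    Z₀-lift : ∀ N {r} → r < a →
      Z₀ F (a * N + r) ≈ nat R (suc r) ⊗ Z₀ L N ⊕ nat R (a ∸ r ∸ 1) ⊗ (x ^ s ⊗ Z₁ L N)
    Z₀-lift N {r} r<a = begin
      ∑< (suc (a * N + r)) f
        ≡⟨ ≡.cong (λ n → ∑< n f) (ℕₚ.+-suc (a * N) r) ⟨
      ∑< (a * N + suc r) f
        ≈⟨ ∑<-lastDigit a N r<a f (λ M → x ^ Δ L 0 N M) h low high ⟩
      nat R (suc r) ⊗ Z₀ L N ⊕ nat R (a ∸ r ∸ 1) ⊗ ∑< N h
        ≈⟨ +-congˡ (*-congˡ (*-distribˡ-∑< N (x ^ s) (λ M → x ^ Δ L 1 N M))) ⟩
      nat R (suc r) ⊗ Z₀ L N ⊕ nat R (a ∸ r ∸ 1) ⊗ (x ^ s ⊗ Z₁ L N) ∎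
      where
      f h : ℕ → A
      f m = x ^ Δ F 0 (a * N + r) m
      h M = x ^ s ⊗ x ^ Δ L 1 N M
      low : ∀ {M j} → M ≤ N → j ≤ r → f (a * M + j) ≈ x ^ Δ L 0 N M
      low M≤N j≤r = reflexive (≡.cong (x ^_) (Δ-low 0 M≤N j≤r r<a))
      high : ∀ {M j} → M < N → r < j → j < a → f (a * M + j) ≈ h M
      high M<N r<j j<a = trans (reflexive (≡.cong (x ^_) (Δ-high 0 z≤n M<N r<j j<a))) (^-homo-* x s _)

    Z₁-lift : ∀ N {r} → r < a →
      Z₁ F (a * N + r) ≈ nat R r ⊗ Z₀ L N ⊕ nat R (a ∸ r) ⊗ (x ^ s ⊗ Z₁ L N)
    Z₁-lift N {r} = byLastDigit r
      where
      f : ℕ → ℕ → A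
      f r m = x ^ Δ F 1 (a * N + r) m
      h : ℕ → A
      h M = x ^ s ⊗ x ^ Δ L 1 N M
      high : ∀ {r M j} → M < N → r < suc j → j < a → f r (a * M + j) ≈ h M
      high M<N r<1+j j<a = trans (reflexive (≡.cong (x ^_) (Δ-high 1 ℕₚ.≤-refl M<N r<1+j j<a))) (^-homo-* x s _)
      byLastDigit : ∀ r → r < a → ∑< (a * N + r) (f r) ≈ nat R r ⊗ Z₀ L N ⊕ nat R (a ∸ r) ⊗ (x ^ s ⊗ Z₁ L N)
      byLastDigit zero _ = begin
        ∑< (a * N + 0) (f 0)
          ≡⟨ ≡.cong (λ n → ∑< n (f 0)) (ℕₚ.+-identityʳ (a * N)) ⟩
        ∑< (a * N) (f 0)
          ≈⟨ ∑<-* a N (f 0) ⟩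
        ∑< N (λ M → ∑< a (λ j → f 0 (a * M + j)))
          ≈⟨ ∑<-cong N (λ M<N → ∑<-const a (high M<N z<s)) ⟩
        ∑< N (λ M → nat R a ⊗ h M)
          ≈⟨ *-distribˡ-∑< N (nat R a) h ⟩
        nat R a ⊗ ∑< N h
          ≈⟨ *-congˡ (*-distribˡ-∑< N (x ^ s) (λ M → x ^ Δ L 1 N M)) ⟩
        nat R a ⊗ (x ^ s ⊗ Z₁ L N)
          ≈⟨ trans (+-congʳ (zeroˡ (Z₀ L N))) (+-identityˡ _) ⟨
        nat R 0 ⊗ Z₀ L N ⊕ nat R a ⊗ (x ^ s ⊗ Z₁ L N) ∎
      byLastDigit (suc r) 1+r<a = begin
        ∑< (a * N + suc r) (f (suc r))
          ≈⟨ ∑<-lastDigit a N (ℕₚ.<-trans (n<1+n r) 1+r<a) (f (suc r)) (λ M → x ^ Δ L 0 N M) h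
                           low (λ M<N r<j → high M<N (s<s r<j)) ⟩
        nat R (suc r) ⊗ Z₀ L N ⊕ nat R (a ∸ r ∸ 1) ⊗ ∑< N h
          ≈⟨ +-congˡ (*-cong (reflexive (≡.cong (nat R) (m∸n∸1≡m∸[1+n] a r)))
                             (*-distribˡ-∑< N (x ^ s) (λ M → x ^ Δ L 1 N M))) ⟩
        nat R (suc r) ⊗ Z₀ L N ⊕ nat R (a ∸ suc r) ⊗ (x ^ s ⊗ Z₁ L N) ∎
        where
        low : ∀ {M j} → M ≤ N → j ≤ r → f (suc r) (a * M + j) ≈ x ^ Δ L 0 N M
        low M≤N j≤r = reflexive (≡.cong (x ^_) (Δ-low 1 M≤N (s≤s j≤r) 1+r<a))

divℤ-+ : ∀ a b .{{_ : NonZero b}} → divℤ (ℤ.+ a) (ℤ.+ b) ≡ ℤ.+ (a / b)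
divℤ-+ a (suc b) = ℤDivMod.div-pos-is-/ℕ (ℤ.+ a) (suc b)

divℕ-*-cancel : ∀ {m n} .{{_ : NonZero n}} → n ∣ m → divℕ m n * n ≡ m
divℕ-*-cancel {n = suc n} = m/n*n≡m

m∣n⇒gcd[m,n]≡m : ∀ {m n} → m ∣ n → gcd m n ≡ m
m∣n⇒gcd[m,n]≡m {m} {n} m∣n = ∣-antisym (gcd[m,n]∣m m n) (gcd-greatest ∣-refl m∣n)

module StrongDivisibility {C : ℕ → ℤ} (C-sds : IsSDS C) where
  open ≡.≡-Reasoning

  c : ℕ → ℕ
  c j = ℤ.∣ C j ∣

  c-gcd : ∀ m n .{{_ : NonZero m}} .{{_ : NonZero n}} → gcd (c m) (c n) ≡ c (gcd m n)
  c-gcd m n = ≡.cong ℤ.∣_∣ (proj₂ C-sds m n (>-nonZero⁻¹ m) (>-nonZero⁻¹ n))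

  C≡+c : ∀ j .{{_ : NonZero j}} → C j ≡ ℤ.+ c j
  C≡+c j = begin
    C j                ≡⟨ ≡.cong C (m∣n⇒gcd[m,n]≡m ∣-refl) ⟨
    C (gcd j j)        ≡⟨ proj₂ C-sds j j (>-nonZero⁻¹ j) (>-nonZero⁻¹ j) ⟨
    ℤ.+ gcd (c j) (c j)  ≡⟨ ≡.cong ℤ.+_ (m∣n⇒gcd[m,n]≡m ∣-refl) ⟩
    ℤ.+ c j              ∎

  c≢0 : ∀ j .{{_ : NonZero j}} → NonZero (c j)
  c≢0 j = ≢-nonZero λ cj≡0 → proj₁ C-sds j (>-nonZero⁻¹ j) (≡.trans (C≡+c j) (≡.cong ℤ.+_ cj≡0))

  c-mono-∣ : ∀ {m n} .{{_ : NonZero m}} .{{_ : NonZero n}} → m ∣ n → c m ∣ c n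
  c-mono-∣ {m} {n} m∣n =
    ≡.subst (_∣ c n) (≡.trans (c-gcd m n) (≡.cong c (m∣n⇒gcd[m,n]≡m m∣n))) (gcd[m,n]∣n (c m) (c n))

  rank-∣ : ∀ {k r j} .{{_ : NonZero j}} → IsRank C k r → k ∣ c j ⇔ r ∣ j
  rank-∣ {k} {r} {j} (1≤r , k∣cr , minimal) = mk⇔ to from
    where
    instance
      r≢0 : NonZero r
      r≢0 = >-nonZero 1≤r
      gcd≢0 : NonZero (gcd j r)
      gcd≢0 = ≢-nonZero (gcd[m,n]≢0 j r (inj₁ (≢-nonZero⁻¹ j)))
    from : r ∣ j → k ∣ c j
    from r∣j = ∣-trans k∣cr (c-mono-∣ r∣j)
    to : k ∣ c j → r ∣ j
    to k∣cj = ≡.subst (_∣ j) gcd≡r (gcd[m,n]∣m j r)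
      where
      k∣c[gcd] : k ∣ c (gcd j r)
      k∣c[gcd] = ≡.subst (k ∣_) (c-gcd j r) (gcd-greatest k∣cj k∣cr)
      gcd≡r : gcd j r ≡ r
      gcd≡r with ℕₚ.m≤n⇒m<n∨m≡n (∣⇒≤ (gcd[m,n]∣n j r))
      ... | inj₁ gcd<r = contradiction k∣c[gcd] (minimal _ (>-nonZero⁻¹ _) gcd<r)
      ... | inj₂ gcd≡r = gcd≡r

  c! : ℕ → ℕ
  c! zero    = 1
  c! (suc n) = c (suc n) * c! n

  c!≢0 : ∀ n → NonZero (c! n)
  c!≢0 zero    = _
  c!≢0 (suc n) = m*n≢0 _ _ {{c≢0 (suc n)}} {{c!≢0 n}}

  c!*c!≢0 : ∀ m k → NonZero (c! m * c! k)
  c!*c!≢0 m k = m*n≢0 (c! m) (c! k) {{c!≢0 m}} {{c!≢0 k}}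

  corial≡+c! : ∀ n → corial C n ≡ ℤ.+ c! n
  corial≡+c! zero    = ≡.refl
  corial≡+c! (suc n) = ≡.trans (≡.cong₂ ℤ._*_ (C≡+c (suc n)) (corial≡+c! n)) (≡.sym (ℤₚ.pos-* (c (suc n)) (c! n)))

  c!-∣ : ∀ m k → c! m * c! k ∣ c! (m + k)
  c!-∣ zero    k      = ∣-reflexive (ℕₚ.*-identityˡ (c! k))
  c!-∣ (suc m) zero    = ∣-reflexive (≡.trans (ℕₚ.*-identityʳ _) (≡.cong c! (≡.sym (ℕₚ.+-identityʳ (suc m)))))
  c!-∣ (suc m) (suc k) = ≡.subst (P ∣_) (ℕₚ.*-comm X (c (suc m + suc k)))
    (∣-trans P∣X*c[g] (*-monoʳ-∣ X (c-mono-∣ g∣1+m+1+k)))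
    where
    instance
      g≢0 : NonZero (gcd (suc m) (suc k))
      g≢0 = ≢-nonZero (gcd[m,n]≢0 (suc m) (suc k) (inj₁ λ ()))
    P X : ℕ
    P = c! (suc m) * c! (suc k)
    X = c! (m + suc k)
    P∣X*c[1+m] : P ∣ X * c (suc m)
    P∣X*c[1+m] = ≡.subst₂ _∣_ (≡.sym (ℕₚ.*-assoc (c (suc m)) (c! m) (c! (suc k)))) (ℕₚ.*-comm (c (suc m)) X)
      (*-monoʳ-∣ (c (suc m)) (c!-∣ m (suc k)))
    P∣X*c[1+k] : P ∣ X * c (suc k)
    P∣X*c[1+k] = ≡.subst₂ _∣_ (*-Comm.x∙yz≈y∙xz (c (suc k)) (c! (suc m)) (c! k)) (ℕₚ.*-comm (c (suc k)) X)
      (*-monoʳ-∣ (c (suc k)) (≡.subst (λ n → c! (suc m) * c! k ∣ c! n) (≡.sym (ℕₚ.+-suc m k)) (c!-∣ (suc m) k)))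
    P∣X*c[g] : P ∣ X * c (gcd (suc m) (suc k))
    P∣X*c[g] = ≡.subst (P ∣_) (≡.trans (≡.sym (c*gcd[m,n]≡gcd[cm,cn] X _ _)) (≡.cong (X *_) (c-gcd (suc m) (suc k))))
      (gcd-greatest P∣X*c[1+m] P∣X*c[1+k])
    g∣1+m+1+k : gcd (suc m) (suc k) ∣ suc m + suc k
    g∣1+m+1+k = ∣m∣n⇒∣m+n (gcd[m,n]∣m (suc m) (suc k)) (gcd[m,n]∣n (suc m) (suc k))

  cnomial≡ : ∀ n m → cnomial C n m ≡ ℤ.+ ((c! n / (c! m * c! (n ∸ m))) {{c!*c!≢0 m (n ∸ m)}})
  cnomial≡ n m = ≡.trans
    (≡.cong₂ divℤ (corial≡+c! n)
                  (≡.trans (≡.cong₂ ℤ._*_ (corial≡+c! m) (corial≡+c! (n ∸ m)))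
                           (≡.sym (ℤₚ.pos-* (c! m) (c! (n ∸ m))))))
    (divℤ-+ (c! n) (c! m * c! (n ∸ m)) {{c!*c!≢0 m (n ∸ m)}})

module AtPrime {C : ℕ → ℤ} (C-sds : IsSDS C) {p : ℕ} (p-prime : Prime p) where
  open StrongDivisibility C-sds
  open Legendre p-prime using (1<p; L)
  open Valuation.Properties 1<p
  open ≡.≡-Reasoning

  νₙ-c! : ∀ n → νₙ p (c! n) ≡ partialSum (νₙ p ∘ c) n
  νₙ-c! zero    = νₙ≡0 (>⇒∤ 1<p)
  νₙ-c! (suc n) = ≡.trans (νₙ-* p-prime (c (suc n)) (c! n) {{c≢0 (suc n)}} {{c!≢0 n}})
                          (≡.cong (νₙ p (c (suc n)) +_) (νₙ-c! n))

  ν-cnomial : ∀ {n m} → m ≤ n → ν p (cnomial C n m) ≡ Δ (νₙ p ∘ c!) 0 n m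
  ν-cnomial {n} {m} m≤n = begin
    ν p (cnomial C n m)
      ≡⟨ ≡.cong (ν p) (cnomial≡ n m) ⟩
    νₙ p q
      ≡⟨ ℕₚ.m+n∸n≡m (νₙ p q) (νₙ p P) ⟨
    (νₙ p q + νₙ p P) ∸ νₙ p P
      ≡⟨ ≡.cong₂ _∸_ νₙ[c!n] (νₙ-* p-prime (c! m) (c! (n ∸ m)) {{c!≢0 m}} {{c!≢0 (n ∸ m)}}) ⟩
    νₙ p (c! n) ∸ (νₙ p (c! m) + νₙ p (c! (n ∸ m))) ∎
    where
    P : ℕ
    P = c! m * c! (n ∸ m)
    instance
      P≢0 : NonZero P
      P≢0 = c!*c!≢0 m (n ∸ m)
    q : ℕ
    q = c! n / P
    P∣c!n : P ∣ c! n
    P∣c!n = ≡.subst (λ k → P ∣ c! k) (ℕₚ.m+[n∸m]≡n m≤n) (c!-∣ m (n ∸ m))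
    instance
      q≢0 : NonZero q
      q≢0 = m*n≢0⇒m≢0 q {{≡.subst NonZero (≡.sym (m/n*n≡m P∣c!n)) (c!≢0 n)}}
    νₙ[c!n] : νₙ p q + νₙ p P ≡ νₙ p (c! n)
    νₙ[c!n] = ≡.trans (≡.sym (νₙ-* p-prime q P)) (≡.cong (νₙ p) (m/n*n≡m P∣c!n))

  module Ideal {α : ℕ → ℕ} {s : ℕ} (ideal : IsIdeal C p α s) where
    open import Data.Nat.Base using (_^_)

    rank : ∀ k .{{_ : NonZero k}} → IsRank C (p ^ k) (α k)
    rank k = proj₁ ideal k (>-nonZero⁻¹ k)

    1≤s : 1 ≤ s
    1≤s = proj₁ (proj₂ ideal)

    aₖ≡1 : ∀ k → 2 ≤ k → k ≤ s → aₖ α k ≡ 1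
    aₖ≡1 = proj₁ (proj₂ (proj₂ ideal))

    aₖ≡p : ∀ k → s < k → aₖ α k ≡ p
    aₖ≡p = proj₂ (proj₂ (proj₂ ideal))

    α≢0 : ∀ k .{{_ : NonZero k}} → NonZero (α k)
    α≢0 k = >-nonZero (proj₁ (rank k))

    instance
      α₁≢0 : NonZero (α 1)
      α₁≢0 = α≢0 1

    α-step : ∀ k → α (2 + k) ≡ aₖ α (2 + k) * α (1 + k)
    α-step k = ≡.sym (divℕ-*-cancel {{α≢0 (1 + k)}} α[1+k]∣α[2+k])
      where
      α[1+k]∣α[2+k] : α (1 + k) ∣ α (2 + k)
      α[1+k]∣α[2+k] = Equivalence.to (rank-∣ {{α≢0 (2 + k)}} (rank (1 + k)))
                        (∣-trans (n∣m*n p) (proj₁ (proj₂ (rank (2 + k)))))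

    α≡ : ∀ k → α (1 + k) ≡ α 1 * p ^ (1 + k ∸ s)
    α≡ zero = ≡.sym (≡.trans (≡.cong (λ e → α 1 * p ^ e) (ℕₚ.m≤n⇒m∸n≡0 1≤s)) (ℕₚ.*-identityʳ (α 1)))
    α≡ (suc k) with 2 + k ℕₚ.≤? s
    ... | yes 2+k≤s = begin
      α (2 + k)                    ≡⟨ α-step k ⟩
      aₖ α (2 + k) * α (1 + k)     ≡⟨ ≡.cong₂ _*_ (aₖ≡1 (2 + k) (s≤s (s≤s z≤n)) 2+k≤s) (α≡ k) ⟩
      1 * (α 1 * p ^ (1 + k ∸ s))  ≡⟨ ℕₚ.*-identityˡ _ ⟩
      α 1 * p ^ (1 + k ∸ s)        ≡⟨ ≡.cong (λ e → α 1 * p ^ e) [1+k]∸s≡[2+k]∸s ⟩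
      α 1 * p ^ (2 + k ∸ s)        ∎
      where
      [1+k]∸s≡[2+k]∸s : 1 + k ∸ s ≡ 2 + k ∸ s
      [1+k]∸s≡[2+k]∸s = ≡.trans (ℕₚ.m≤n⇒m∸n≡0 (ℕₚ.<⇒≤ 2+k≤s)) (≡.sym (ℕₚ.m≤n⇒m∸n≡0 2+k≤s))
    ... | no 2+k≰s = begin
      α (2 + k)                    ≡⟨ α-step k ⟩
      aₖ α (2 + k) * α (1 + k)     ≡⟨ ≡.cong₂ _*_ (aₖ≡p (2 + k) s<2+k) (α≡ k) ⟩
      p * (α 1 * p ^ (1 + k ∸ s))  ≡⟨ *-Comm.x∙yz≈y∙xz p (α 1) _ ⟩
      α 1 * p ^ (1 + (1 + k ∸ s))  ≡⟨ ≡.cong (λ e → α 1 * p ^ e) (ℕₚ.+-∸-assoc 1 (ℕₚ.≤-pred s<2+k)) ⟨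
      α 1 * p ^ (2 + k ∸ s)        ∎
      where
      s<2+k : s < 2 + k
      s<2+k = ℕₚ.≰⇒> 2+k≰s

    p^k∣c⇔ : ∀ k {j} .{{_ : NonZero k}} .{{_ : NonZero j}} → p ^ k ∣ c j ⇔ α 1 * p ^ (k ∸ s) ∣ j
    p^k∣c⇔ (suc k) = ≡.subst (λ r → p ^ suc k ∣ c _ ⇔ r ∣ _) (α≡ k) (rank-∣ (rank (suc k)))

    νₙ-c-off : ∀ {j} → ¬ α 1 ∣ suc j → νₙ p (c (suc j)) ≡ 0
    νₙ-c-off {j} α₁∤ = νₙ≡0 {{c≢0 (suc j)}} λ p∣c →
      α₁∤ (Equivalence.to (rank-∣ (rank 1)) (≡.subst (_∣ c (suc j)) (≡.sym (ℕₚ.*-identityʳ p)) p∣c))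

    νₙ-c-on : ∀ t .{{_ : NonZero t}} → νₙ p (c (α 1 * t)) ≡ s + νₙ p t
    νₙ-c-on t = νₙ-unique {{c≢0 (α 1 * t)}} p^[s+v]∣ p^[1+s+v]∤
      where
      instance
        α₁t≢0 : NonZero (α 1 * t)
        α₁t≢0 = m*n≢0 (α 1) t
        s+v≢0 : NonZero (s + νₙ p t)
        s+v≢0 = >-nonZero (ℕₚ.≤-trans 1≤s (ℕₚ.m≤m+n s (νₙ p t)))
      v : ℕ
      v = νₙ p t
      p^[s+v]∣ : p ^ (s + v) ∣ c (α 1 * t)
      p^[s+v]∣ = Equivalence.from (p^k∣c⇔ (s + v))
        (*-monoʳ-∣ (α 1) (≡.subst (λ e → p ^ e ∣ t) (≡.sym (ℕₚ.m+n∸m≡n s v)) (p^νₙ∣n t)))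
      p^[1+s+v]∤ : ¬ p ^ suc (s + v) ∣ c (α 1 * t)
      p^[1+s+v]∤ h = p^1+νₙ∤n t (≡.subst (λ e → p ^ e ∣ t) [1+s+v]∸s≡1+v
        (*-cancelˡ-∣ (α 1) (Equivalence.to (p^k∣c⇔ (suc (s + v))) h)))
        where
        [1+s+v]∸s≡1+v : suc (s + v) ∸ s ≡ suc v
        [1+s+v]∸s≡1+v = ≡.trans (ℕₚ.+-∸-assoc 1 (ℕₚ.m≤m+n s v)) (≡.cong suc (ℕₚ.m+n∸m≡n s v))

    F-digits : ∀ N {r} → r < α 1 → νₙ p (c! (α 1 * N + r)) ≡ s * N + L N
    F-digits N r<α₁ = ≡.trans (νₙ-c! (α 1 * N + _))
      (partialSum-digits {g = νₙ p ∘ c} νₙ-c-off (λ t → νₙ-c-on (suc t)) N r<α₁)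

digits-go-suc : ∀ {f p n} .{{_ : NonZero p}} →
  digits-go (suc f) p n ≡ n % p ∷ (if n / p ≡ᵇ 0 then [] else digits-go f p (n / p))
digits-go-suc {p = suc _} = ≡.refl

module DigitProduct {c ℓ : Level} (R : CommutativeSemiring c ℓ) (x : CommutativeSemiring.Carrier R)
                    {p : ℕ} (p-prime : Prime p) where
  open CommutativeSemiring R renaming (Carrier to A; _+_ to _⊕_; _*_ to _⊗_)
  open SemiringSolver R using (_:+_; _:*_; _:=_) renaming (solve to solveᴿ)
  open import Data.Product using (_×_)
  open CarrySums R x
  open Legendre p-prime
  open Lift {p} {1} {L} {L} L-digits L-superadditive
  open Valuation.Properties 1<p using (p≢0)
  open Setoid (×-setoid setoid setoid) using () renaming (_≈_ to _≈₂_)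

  carryVector : ℕ → A × A
  carryVector N = Z₀ L N , x ⊗ Z₁ L N

  Mp·-cong : ∀ d {u v} → u ≈₂ v → Mp· R p x d u ≈₂ Mp· R p x d v
  Mp·-cong d (u₁≈v₁ , u₂≈v₂) =
    +-cong (*-congˡ u₁≈v₁) (*-congˡ u₂≈v₂) , +-cong (*-congˡ u₁≈v₁) (*-congˡ u₂≈v₂)

  carryVector-digit : ∀ N {d} → d < p → carryVector (p * N + d) ≈₂ Mp· R p x d (carryVector N)
  carryVector-digit N {d} d<p =
      trans (Z₀-lift N d<p) (+-congˡ (*-congˡ (*-congʳ (*-identityʳ x))))
    , trans (*-congˡ (trans (Z₁-lift N d<p) (+-congˡ (*-congˡ (*-congʳ (*-identityʳ x))))))
            (solveᴿ 5 (λ x a b Z W → x :* (a :* Z :+ b :* (x :* W)) := (a :* x) :* Z :+ (b :* x) :* (x :* W))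
                    refl x (nat R d) (nat R (p ∸ d)) (Z₀ L N) (Z₁ L N))

  Mprod-digits-go : ∀ f n → n < f → Mprod R p x (digits-go f p n) ≈₂ carryVector n
  Mprod-digits-go (suc f) n (s≤s n≤f) = begin
    Mprod R p x (digits-go (suc f) p n)                ≡⟨ ≡.cong (Mprod R p x) digits-go-suc ⟩
    Mp· R p x (n % p) (Mprod R p x higherDigits)       ≈⟨ Mp·-cong (n % p) (Mprod-higherDigits (n / p) ≡.refl) ⟩
    Mp· R p x (n % p) (carryVector (n / p))            ≈⟨ carryVector-digit (n / p) (m%n<n n p) ⟨
    carryVector (p * (n / p) + n % p)                  ≡⟨ ≡.cong carryVector p[n/p]+n%p≡n ⟩
    carryVector n                                      ∎
    where
    open SetoidReasoning (×-setoid setoid setoid)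
    higherDigits : List ℕ
    higherDigits = if n / p ≡ᵇ 0 then [] else digits-go f p (n / p)
    Mprod-higherDigits : ∀ k → k ≡ n / p → Mprod R p x (if k ≡ᵇ 0 then [] else digits-go f p k) ≈₂ carryVector k
    Mprod-higherDigits zero    _ = sym (+-identityʳ 1#) , sym (zeroʳ x)
    Mprod-higherDigits (suc k) 1+k≡n/p = Mprod-digits-go f (suc k) (ℕₚ.<-≤-trans 1+k<n n≤f)
      where
      instance
        n≢0 : NonZero n
        n≢0 = ≢-nonZero λ { ≡.refl → ℕₚ.0≢1+n (≡.trans (≡.sym (0/n≡0 p)) (≡.sym 1+k≡n/p)) }
      1+k<n : suc k < n
      1+k<n = ≡.subst (_< n) (≡.sym 1+k≡n/p) (m/n<m n p 1<p)
    p[n/p]+n%p≡n : p * (n / p) + n % p ≡ n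
    p[n/p]+n%p≡n = ≡.sym (≡.trans (m≡m%n+[m/n]*n n p)
                     (≡.trans (ℕₚ.+-comm (n % p) _) (≡.cong (_+ n % p) (ℕₚ.*-comm (n / p) p))))

  Mprod-digits : ∀ n → Mprod R p x (digits p n) ≈₂ carryVector n
  Mprod-digits n = Mprod-digits-go (suc n) n ℕₚ.≤-refl

theorem1p1 : (C : ℕ → ℤ) → IsSDS C → (p : ℕ) → Prime p → (α : ℕ → ℕ) → (s : ℕ) → IsIdeal C p α s
    → (n r : ℕ) → r < α 1
    → {c ℓ : Level} (R : CommutativeSemiring c ℓ) (x : CommutativeSemiring.Carrier R)
    → CommutativeSemiring._≈_ R (T R p C (α 1 * n + r) x) (RHS R p α s n r x)
theorem1p1 C C-sds p p-prime α s ideal n r r<α₁ R x = begin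
  T R p C N x
    ≡⟨ foldr-applyUpTo (λ m → x ^ ν p (cnomial C N m)) id (suc N) ⟩
  ∑< (suc N) (λ m → x ^ ν p (cnomial C N m))
    ≈⟨ ∑<-cong (suc N) (λ m<1+N → reflexive (≡.cong (x ^_) (ν-cnomial (ℕₚ.≤-pred m<1+N)))) ⟩
  Z₀ (νₙ p ∘ c!) N
    ≈⟨ Z₀-lift n r<α₁ ⟩
  nat R (suc r) ⊗ Z₀ L n ⊕ nat R (α 1 ∸ r ∸ 1) ⊗ (x ^ s ⊗ Z₁ L n)
    ≈⟨ +-congˡ x^s-split ⟩
  nat R (suc r) ⊗ Z₀ L n ⊕ (nat R (α 1 ∸ r ∸ 1) ⊗ x ^ (s ∸ 1)) ⊗ (x ⊗ Z₁ L n)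
    ≈⟨ +-cong (*-congˡ (proj₁ (Mprod-digits n))) (*-congˡ (proj₂ (Mprod-digits n))) ⟨
  RHS R p α s n r x ∎
  where
  open CommutativeSemiring R renaming (_+_ to _⊕_; _*_ to _⊗_)
  open SemiringExp semiring using (_^_)
  open SemiringSolver R using (_:+_; _:*_; _:=_) renaming (solve to solveᴿ)
  open SetoidReasoning setoid
  open FiniteSums R
  open CarrySums R x
  open StrongDivisibility C-sds
  open AtPrime C-sds p-prime
  open Ideal ideal
  open Legendre p-prime using (L; L-superadditive)
  open Lift {α 1} {s} {L} {νₙ p ∘ c!} F-digits L-superadditive
  open DigitProduct R x p-prime using (Mprod-digits)
  N : ℕ
  N = α 1 * n + r
  x^s-split : nat R (α 1 ∸ r ∸ 1) ⊗ (x ^ s ⊗ Z₁ L n) ≈ (nat R (α 1 ∸ r ∸ 1) ⊗ x ^ (s ∸ 1)) ⊗ (x ⊗ Z₁ L n)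
  x^s-split = trans (*-congˡ (*-congʳ (reflexive (≡.cong (x ^_) (≡.sym (ℕₚ.m+[n∸m]≡n 1≤s))))))
    (solveᴿ 4 (λ b x y W → b :* ((x :* y) :* W) := (b :* y) :* (x :* W)) refl _ x (x ^ (s ∸ 1)) (Z₁ L n))
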